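{- Vertex covers can be learned by equivalence queries in $O(n^2)$ rounds: there is a learning algorithm that makes only (non-extended) equivalence queries, with hypotheses that are graphs on $\{1,\dots,n\}$, and that, for every graph $G$ on $\{1,\dots,n\}$ and every competent Teacher, produces a hypothesis graph $H$ that is equivalent to $G$ with respect to the vertex cover concept after $O(n^2)$ queries.
   Context: A vertex set concept is a predicate $\Phi(G,V')$ on finite graphs $G$ and sets $V'\subseteq V(G)$; its solution set is $S(G)=\{V'\subseteq V(G):\Phi(G,V')\}$. Graphs $G,H$ are $\Phi$-equivalent if $V(G)=V(H)$ and $S(G)=S(H)$. Here $\Phi(G,V')$ means "$V'$ is a vertex cover of $G$", i.e. every edge of $G$ has at least one endpoint in $V'$. Learning model (exact learning by equivalence queries): a Teacher privately holds a graph $G$ with vertex set $V=\{1,\dots,n\}$, and the Learner initially knows only $n$. In an equivalence query the Learner presents a hypothesis graph $H$ on $\{1,\dots,n\}$. If $H$ is $\Phi$-equivalent to $G$, the Teacher answers "finished". Otherwise the Teacher returns a counterexample: either a positive counterexample, i.e. a set $V'$ with $\Phi(G,V')$ true and $\Phi(H,V')$ false, or a negative counterexample, i.e. a set $V'$ with $\Phi(H,V')$ true and $\Phi(G,V')$ false. A Teacher is competent if it always answers queries correctly; it may choose any valid counterexample. A learning algorithm for $\Phi$ is a Learner strategy that, against every competent Teacher and every graph $G$, eventually obtains the answer "finished". It runs in $f(n)$ rounds if, for every graph of order $n$ and every competent Teacher, it finishes after at most $f(n)$ queries. -}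

module Defs where

open import Data.Nat using (ℕ; zero; suc; _+_; _*_)
open import Data.Fin using (Fin)
open import Data.Fin.Subset using (Subset; _∈_)
open import Data.Bool using (Bool; true; false)
open import Data.List using (List; []; _∷_; _++_; [_])
open import Data.Product using (Σ; _×_; _,_)
open import Data.Sum using (_⊎_)
open import Data.Empty using (⊥)
open import Relation.Nullary using (¬_)
open import Relation.Binary.PropositionalEquality using (_≡_)

-- A finite simple graph on the vertex set {1,…,n}, represented as Fin n,
-- given by a symmetric, irreflexive Boolean adjacency relation.
record Graph (n : ℕ) : Set where
  field
    adj     : Fin n → Fin n → Bool
    sym     : ∀ i j → adj i j ≡ adj j i
    irrefl  : ∀ i → adj i i ≡ false
open Graph public

IsVertexCover : ∀ {n} → Graph n → Subset n → Set
IsVertexCover G V' = ∀ i j → adj G i j ≡ true → (i ∈ V') ⊎ (j ∈ V')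

VCEquivalent : ∀ {n} → Graph n → Graph n → Set
VCEquivalent G H = ∀ V' → (IsVertexCover G V' → IsVertexCover H V')
                          × (IsVertexCover H V' → IsVertexCover G V')

data Polarity : Set where
  positive negative : Polarity

ValidCounterexample : ∀ {n} → (G H : Graph n) → Polarity → Subset n → Set
ValidCounterexample G H positive V' = IsVertexCover G V' × ¬ IsVertexCover H V'
ValidCounterexample G H negative V' = IsVertexCover H V' × ¬ IsVertexCover G V'

-- A round of the interaction: the hypothesis posed and the counterexample received.
Round : ℕ → Set
Round n = Graph n × Polarity × Subset n

History : ℕ → Set
History n = List (Round n)

-- A Learner strategy (uniform in n, which is all it knows initially):
-- given n and the history so far, it poses the next hypothesis graph.
Learner : Set
Learner = (n : ℕ) → History n → Graph n

-- A competent Teacher for the target G: whenever the hypothesis H is not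
-- equivalent to G, it returns (adaptively, depending on the history) some
-- valid counterexample; when H is equivalent it answers "finished".
CompetentTeacher : ∀ {n} → Graph n → Set
CompetentTeacher {n} G =
  (h : History n) (H : Graph n) → ¬ VCEquivalent G H →
  Σ Polarity λ p → Σ (Subset n) λ V' → ValidCounterexample G H p V'

-- FinishedWithin L G T k h : starting from history h, the Learner L obtains
-- "finished" from the Teacher T (for target G) after at most k further queries.
FinishedWithin : ∀ {n} → Learner → (G : Graph n) → CompetentTeacher G →
                 ℕ → History n → Set
FinishedWithin L G T zero h = ⊥
FinishedWithin {n} L G T (suc k) h =
  (ne : ¬ VCEquivalent G (L n h)) →
  (let (p , V' , _) = T h (L n h) ne
   in FinishedWithin L G T k (h ++ [ (L n h , p , V') ]))

{-# OPTIONS --safe #-}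
-- The Learner's hypothesis is the complete graph with every pair removed that
-- some earlier counterexample failed to cover. Since the Teacher is competent,
-- every counterexample it returns is a vertex cover of the target G, so G stays
-- a subgraph of the hypothesis. Vertex covers are antitone in the graph, hence
-- no negative counterexample can ever arise, and each positive counterexample
-- deletes at least one of the at most n * n ordered pairs of the hypothesis.
module Submission where

open import Defs hiding (sym)
open import Data.Nat using (ℕ; zero; suc; _*_; _+_; _<_; z<s; s≤s⁻¹)
open import Data.Nat.Properties using (<-≤-trans; *-identityˡ; m<m+n; module ≤-Reasoning)
open import Data.Bool using (Bool; true; false; _∧_)
import Data.Bool.Properties as Bool
open import Data.Fin using (Fin; _≟_; combine; remQuot)
open import Data.Fin.Properties using (all?; ¬∀⟶∃¬; remQuot-combine)
open import Data.Fin.Subset using (Subset; _∈_; _∉_; _⊂_; ∣_∣)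
open import Data.Fin.Subset.Properties using (_∈?_; ∣p∣≤n; p⊂q⇒∣p∣<∣q∣)
open import Data.Vec using (tabulate)
open import Data.Vec.Properties using (lookup∘tabulate; lookup⇒[]=; []=⇒lookup)
open import Data.List using ([]; _++_; [_]; foldl)
open import Data.List.Properties using (foldl-∷ʳ)
open import Data.Product using (Σ; ∃₂; _×_; _,_; uncurry)
open import Data.Sum using (_⊎_; inj₁; inj₂; [_,_]′)
import Data.Sum as Sum
open import Function using (_∘_)
open import Function.Bundles using (mk⇔)
open import Relation.Nullary using (¬_; Dec; yes; no; does; ¬?; contradiction)
open import Relation.Nullary.Decidable using (dec-true; dec-false; does-⇔; _⊎-dec_; _→-dec_)
open import Relation.Binary.PropositionalEquality using (_≡_; refl; sym; trans; cong; cong₂; subst)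

private
  variable
    n : ℕ

¬→⇒×¬ : ∀ {a b} {A : Set a} {B : Set b} → Dec A → ¬ (A → B) → A × ¬ B
¬→⇒×¬ (yes a) ¬a→b = a , λ b → ¬a→b (λ _ → b)
¬→⇒×¬ (no ¬a) ¬a→b = contradiction (λ a → contradiction a ¬a) ¬a→b

infix 4 _⊆ᴳ_

_⊆ᴳ_ : Graph n → Graph n → Set
G ⊆ᴳ H = ∀ {i j} → adj G i j ≡ true → adj H i j ≡ true

isVertexCover-antitone : ∀ {G H : Graph n} {V} → G ⊆ᴳ H → IsVertexCover H V → IsVertexCover G V
isVertexCover-antitone G⊆H coversH i j e = coversH i j (G⊆H e)

uncoveredEdge : ∀ (H : Graph n) V → ¬ IsVertexCover H V →
                ∃₂ λ i j → adj H i j ≡ true × i ∉ V × j ∉ V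
uncoveredEdge {n} H V ¬covers =
  let i , ¬coveredAt-i = ¬∀⟶∃¬ n _ (λ i → all? (covered? i)) ¬covers
      j , ¬covered-ij  = ¬∀⟶∃¬ n _ (covered? i) ¬coveredAt-i
      edge , ¬covered  = ¬→⇒×¬ (adj H i j Bool.≟ true) ¬covered-ij
  in i , j , edge , ¬covered ∘ inj₁ , ¬covered ∘ inj₂
  where
  covered? : ∀ i j → Dec (adj H i j ≡ true → i ∈ V ⊎ j ∈ V)
  covered? i j = (adj H i j Bool.≟ true) →-dec ((i ∈? V) ⊎-dec (j ∈? V))

edges : Graph n → Subset (n * n)
edges {n} G = tabulate (uncurry (adj G) ∘ remQuot n)

∈-tabulate⁺ : ∀ {m} {f : Fin m → Bool} {x} → f x ≡ true → x ∈ tabulate f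
∈-tabulate⁺ {f = f} {x} fx = lookup⇒[]= x _ (trans (lookup∘tabulate f x) fx)

∈-tabulate⁻ : ∀ {m} {f : Fin m → Bool} {x} → x ∈ tabulate f → f x ≡ true
∈-tabulate⁻ {f = f} {x} x∈ = trans (sym (lookup∘tabulate f x)) ([]=⇒lookup x∈)

edges-⊂ : ∀ {G H : Graph n} {i j} → G ⊆ᴳ H → adj H i j ≡ true → adj G i j ≡ false →
          edges G ⊂ edges H
edges-⊂ {n} {G} {H} {i} {j} G⊆H eH eG =
  ∈-tabulate⁺ ∘ G⊆H ∘ ∈-tabulate⁻ ,
  combine i j ,
  ∈-tabulate⁺ (at (adj H) eH) ,
  λ ij∈G → contradiction (trans (sym (at (adj G) eG)) (∈-tabulate⁻ ij∈G)) λ ()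
  where
  at : ∀ (R : Fin n → Fin n → Bool) {b} → R i j ≡ b → uncurry R (remQuot n (combine i j)) ≡ b
  at R Rij = trans (cong (uncurry R) (remQuot-combine i j)) Rij

complete : ∀ n → Graph n
complete n = record
  { adj    = λ i j → does (¬? (i ≟ j))
  ; sym    = λ i j → does-⇔ (mk⇔ (_∘ sym) (_∘ sym)) (¬? (i ≟ j)) (¬? (j ≟ i))
  ; irrefl = λ i → dec-false (¬? (i ≟ i)) (λ i≢i → i≢i refl)
  }

⊆ᴳ-complete : ∀ (G : Graph n) → G ⊆ᴳ complete n
⊆ᴳ-complete G {i} {j} e =
  dec-true (¬? (i ≟ j)) λ { refl → contradiction (trans (sym e) (irrefl G i)) λ () }

covers? : ∀ (V : Subset n) i j → Dec (i ∈ V ⊎ j ∈ V)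
covers? V i j = (i ∈? V) ⊎-dec (j ∈? V)

keepCovered : Graph n → Subset n → Graph n
keepCovered H V = record
  { adj    = λ i j → adj H i j ∧ does (covers? V i j)
  ; sym    = λ i j → cong₂ _∧_ (Graph.sym H i j)
                       (does-⇔ (mk⇔ Sum.swap Sum.swap) (covers? V i j) (covers? V j i))
  ; irrefl = λ i → cong (_∧ does (covers? V i i)) (irrefl H i)
  }

keepCovered-⊆ᴳ : ∀ (H : Graph n) V → keepCovered H V ⊆ᴳ H
keepCovered-⊆ᴳ H V {i} {j} e with adj H i j
... | true  = refl
... | false = e

⊆ᴳ-keepCovered : ∀ {G H : Graph n} {V} → G ⊆ᴳ H → IsVertexCover G V → G ⊆ᴳ keepCovered H V
⊆ᴳ-keepCovered {V = V} G⊆H coversG {i} {j} e =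
  cong₂ _∧_ (G⊆H e) (dec-true (covers? V i j) (coversG i j e))

keepCovered-uncovered : ∀ (H : Graph n) V {i j} → i ∉ V → j ∉ V →
                        adj (keepCovered H V) i j ≡ false
keepCovered-uncovered H V {i} {j} i∉V j∉V =
  trans (cong (adj H i j ∧_) (dec-false (covers? V i j) [ i∉V , j∉V ]′)) (Bool.∧-zeroʳ (adj H i j))

∣edges-keepCovered∣< : ∀ (H : Graph n) V → ¬ IsVertexCover H V →
                       ∣ edges (keepCovered H V) ∣ < ∣ edges H ∣
∣edges-keepCovered∣< H V ¬covers =
  let i , j , e , i∉V , j∉V = uncoveredEdge H V ¬covers
  in p⊂q⇒∣p∣<∣q∣ (edges-⊂ {G = keepCovered H V} {H} {i} {j}
                    (keepCovered-⊆ᴳ H V) e (keepCovered-uncovered H V i∉V j∉V))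

hypothesis : History n → Graph n
hypothesis = foldl (λ H (_ , _ , V) → keepCovered H V) (complete _)

hypothesis-∷ʳ : ∀ (h : History n) H p V →
                hypothesis (h ++ [ (H , p , V) ]) ≡ keepCovered (hypothesis h) V
hypothesis-∷ʳ h H p V = foldl-∷ʳ _ (complete _) (H , p , V) h

learner : Learner
learner _ = hypothesis

module _ {n} (G : Graph n) (T : CompetentTeacher G) where

  finishedWithin : ∀ k h → G ⊆ᴳ hypothesis h → ∣ edges (hypothesis h) ∣ < k →
                   FinishedWithin learner G T k h
  finishedWithin zero    h _   ()
  finishedWithin (suc k) h G⊆H ∣E∣<1+k ¬equiv =
    let p , V , valid = T h (hypothesis h) ¬equiv in answer p V valid
    where
    answer : ∀ p V → ValidCounterexample G (hypothesis h) p V →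
             FinishedWithin learner G T k (h ++ [ (hypothesis h , p , V) ])
    answer negative V (coversH , ¬coversG) =
      contradiction (isVertexCover-antitone {G = G} {hypothesis h} {V} G⊆H coversH) ¬coversG
    answer positive V (coversG , ¬coversH) =
      finishedWithin k _
        (subst (G ⊆ᴳ_) (sym refined) (⊆ᴳ-keepCovered {G = G} {hypothesis h} {V} G⊆H coversG))
        (subst (λ H → ∣ edges H ∣ < k) (sym refined)
          (<-≤-trans (∣edges-keepCovered∣< (hypothesis h) V ¬coversH) (s≤s⁻¹ ∣E∣<1+k)))
      where
      refined : hypothesis (h ++ [ (hypothesis h , positive , V) ]) ≡ keepCovered (hypothesis h) V
      refined = hypothesis-∷ʳ h (hypothesis h) positive V

theorem2p1 : Σ Learner λ L → Σ ℕ λ c →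
    ∀ (n : ℕ) (G : Graph n) (T : CompetentTeacher G) →
      FinishedWithin L G T (c * (n * n) + c) []
theorem2p1 = learner , 1 , λ n G T → finishedWithin G T _ [] (⊆ᴳ-complete G) (edgeBound n)
  where
  edgeBound : ∀ n → ∣ edges (complete n) ∣ < 1 * (n * n) + 1
  edgeBound n = begin-strict
    ∣ edges (complete n) ∣  ≤⟨ ∣p∣≤n (edges (complete n)) ⟩
    n * n                   ≡⟨ *-identityˡ (n * n) ⟨
    1 * (n * n)             <⟨ m<m+n (1 * (n * n)) z<s ⟩
    1 * (n * n) + 1         ∎
    where open ≤-Reasoning
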